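{- Let $G=(V,E)$ be a graph and $k\in\mathbb{N}$. Let $S$ be an isolated stable set class of $G$ with $|S|\ge k^5$ and $|V\setminus S|\le k^3$. Then $G$ is $k$-equidominating if and only if there exists a $k$-equidominating function of $G$ that is constant on $S$.
   Context: All graphs are finite, simple and undirected; $\mathbb{N}=\{1,2,\dots\}$. An mds is an inclusion-minimal set $D\subseteq V$ such that every vertex is in $D$ or adjacent to a vertex of $D$. A $k$-equidominating function of $G$ is a map $w\colon V\to\{1,\dots,k\}$ for which there is $t\in\mathbb{N}$ such that for all $D\subseteq V$: $D$ is an mds iff $\sum_{v\in D}w(v)=t$; $G$ is $k$-equidominating if such a function exists. Two vertices $v,w$ are twins if $N(v)\setminus\{w\}=N(w)\setminus\{v\}$; a stable set class is an equivalence class of the twin relation with at least two pairwise non-adjacent vertices; it is isolated if none of its vertices has a neighbor. -}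

module Defs where

open import Data.Nat using (ℕ; zero; suc; _+_; _≤_)
open import Data.Bool using (Bool; true; false; if_then_else_)
open import Data.Fin using (Fin)
import Data.Fin as Fin
open import Data.Fin.Subset using (Subset; _∈_; _∉_; _⊆_; ∣_∣)
open import Data.Vec using ([]; _∷_)
open import Data.Product using (Σ; ∃; _×_; _,_)
open import Data.Sum using (_⊎_)
open import Function using (_∘_)
open import Function.Bundles using (_⇔_)
open import Relation.Binary.PropositionalEquality using (_≡_; _≢_)
open import Relation.Nullary using (¬_)

record Graph (n : ℕ) : Set where
  field
    adj    : Fin n → Fin n → Bool
    sym    : ∀ u v → adj u v ≡ adj v u
    irrefl : ∀ v → adj v v ≡ false

module _ {n : ℕ} (G : Graph n) where
  open Graph G

  Adj : Fin n → Fin n → Set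
  Adj u v = adj u v ≡ true

  Dominating : Subset n → Set
  Dominating D = ∀ v → v ∈ D ⊎ (∃ λ u → u ∈ D × Adj u v)

  MDS : Subset n → Set
  MDS D = Dominating D × (∀ D′ → D′ ⊆ D → Dominating D′ → D′ ≡ D)

  Twin : Fin n → Fin n → Set
  Twin v w = ∀ x → x ≢ v → x ≢ w → (Adj v x ⇔ Adj w x)

  StableSetClass : Subset n → Set
  StableSetClass S =
    (∃ λ v → v ∈ S × (∀ x → (x ∈ S ⇔ Twin v x)))
    × 2 ≤ ∣ S ∣
    × (∀ u v → u ∈ S → v ∈ S → ¬ Adj u v)

  IsolatedStableSetClass : Subset n → Set
  IsolatedStableSetClass S =
    StableSetClass S × (∀ v → v ∈ S → ∀ u → ¬ Adj v u)

wsum : ∀ {n} → (Fin n → ℕ) → Subset n → ℕ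
wsum {zero}  w []      = 0
wsum {suc n} w (b ∷ D) = (if b then w Fin.zero else 0) + wsum (w ∘ Fin.suc) D

module _ {n : ℕ} (G : Graph n) where

  IsEquidominatingFn : ℕ → (Fin n → ℕ) → Set
  IsEquidominatingFn k w =
    (∀ v → 1 ≤ w v × w v ≤ k)
    × (∃ λ t → 1 ≤ t × (∀ D → (MDS G D ⇔ wsum w D ≡ t)))

  Equidominating : ℕ → Set
  Equidominating k = ∃ λ w → IsEquidominatingFn k w

ConstantOn : ∀ {n} → (Fin n → ℕ) → Subset n → Set
ConstantOn w S = ∀ u v → u ∈ S → v ∈ S → w u ≡ w v

module Submission where

-- Let w be a k-equidominating function with target t.
-- Every vertex of the isolated class S lies in every dominating set, so every
-- mds D contains S and the weight of D splits as w(S) + w(D ∖ S).  Since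
-- |S| ≥ k⁵ and w takes values in [1,k], some value c is taken by at least
-- k⁴ vertices of S (pigeonhole), and k⁴ ≥ k·|V ∖ S| bounds the total weight
-- outside S.  Putting weight c on all of S then gives an equidominating
-- function with target (t − w(S)) + c·|S|: a set D ⊉ S reaching this target
-- would have w(D ∖ S) = (t − w(S)) + c·j with j = |S ∖ D| ≥ 1, and trading j
-- vertices of S of weight c for D ∩ S would produce an mds missing a vertex
-- of S — impossible.

open import Defs
open import Data.Nat using (ℕ; zero; suc; _+_; _*_; _∸_; _≤_; _<_; _^_; _<ᵇ_; _≡ᵇ_; z≤n; s≤s; _≤?_)
open import Data.Nat.Properties
open import Data.Nat.Solver using (module +-*-Solver)
open import Data.Bool using (Bool; true; false; not; _∧_; if_then_else_; T)
import Data.Bool as Bool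
open import Data.Bool.Properties using (∧-comm; ∧-zeroʳ; ∧-identityʳ; T-≡)
open import Data.Fin using (Fin) renaming (zero to fzero; suc to fsuc)
open import Data.Fin.Properties using (any?; all?)
open import Data.Fin.Subset using (Subset; ∁; ∣_∣; ⊤; _⊂_) renaming (_⊆_ to _⊆ᵥ_)
open import Data.Fin.Subset.Properties using (_∈?_; _⊂?_; anySubset?; ⊆-antisym; p⊂q⇒∣p∣<∣q∣; ∣p∣≤n; ∈⊤)
import Data.Vec.Functional as Vector
open import Data.Vec using ([]; _∷_; lookup; tabulate)
open import Data.Vec.Properties using (lookup-map; lookup∘tabulate; []=⇒lookup; lookup⇒[]=)
open import Data.Product using (∃; _×_; _,_; proj₁; proj₂)
open import Data.Sum using (_⊎_; inj₁; inj₂)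
open import Data.Empty using (⊥; ⊥-elim)
open import Data.Unit using (tt)
open import Function using (_∘_)
open import Function.Bundles using (_⇔_; mk⇔; Equivalence)
open import Relation.Binary.PropositionalEquality
open import Relation.Nullary using (¬_; Dec; yes; no; ¬?; _×-dec_; _⊎-dec_)
open import Relation.Nullary.Decidable using (decidable-stable)
open import Algebra.Properties.Semiring.Sum +-*-semiring
  using (sum; sum-cong-≗; ∑-distrib-+; *-distribˡ-sum; sum-replicate-zero; sum-remove)

ℙ : ℕ → Set
ℙ n = Fin n → Bool

infixr 7 _∩_
infixl 6 _∖_
infix  4 _⊆_

_∩_ : ∀ {n} → ℙ n → ℙ n → ℙ n
(A ∩ B) v = A v ∧ B v

_∖_ : ∀ {n} → ℙ n → ℙ n → ℙ n
(A ∖ B) v = A v ∧ not (B v)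

_⊆_ : ∀ {n} → ℙ n → ℙ n → Set
A ⊆ B = ∀ v → A v ≡ true → B v ≡ true

∧-elimˡ : ∀ a {b} → a ∧ b ≡ true → a ≡ true
∧-elimˡ true _ = refl

∧-elimʳ : ∀ a {b} → a ∧ b ≡ true → b ≡ true
∧-elimʳ true b≡true = b≡true

∩-⊆ : ∀ {n} {A B : ℙ n} → A ⊆ B → ∀ v → (B ∩ A) v ≡ A v
∩-⊆ {A = A} {B} A⊆B v with A v in A-v
... | true  = trans (∧-identityʳ (B v)) (A⊆B v A-v)
... | false = ∧-zeroʳ (B v)

patch : ∀ {n} → ℙ n → ℙ n → ℙ n → ℙ n
patch S E D v = if S v then E v else D v

patch-∩ : ∀ {n} (S E D : ℙ n) v → (patch S E D ∩ S) v ≡ (S ∩ E) v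
patch-∩ S E D v with S v
... | true  = ∧-identityʳ (E v)
... | false = ∧-zeroʳ (D v)

patch-∖ : ∀ {n} (S E D : ℙ n) v → (patch S E D ∖ S) v ≡ (D ∖ S) v
patch-∖ S E D v with S v
... | true  = trans (∧-zeroʳ (E v)) (sym (∧-zeroʳ (D v)))
... | false = refl

⊆-or-witness : ∀ {n} (A B : ℙ n) → A ⊆ B ⊎ ∃ λ v → (A ∖ B) v ≡ true
⊆-or-witness A B with any? (λ v → (A ∖ B) v Bool.≟ true)
... | yes witness = inj₂ witness
... | no  none    = inj₁ A⊆B
  where
    A⊆B : A ⊆ B
    A⊆B v A-v with B v in B-v
    ... | true  = refl
    ... | false = ⊥-elim (none (v , subst₂ (λ a b → a ∧ not b ≡ true) (sym A-v) (sym B-v) refl))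

weight : ∀ {n} → ℙ n → (Fin n → ℕ) → ℕ
weight A f = sum (λ v → if A v then f v else 0)

size : ∀ {n} → ℙ n → ℕ
size A = weight A (λ _ → 1)

sum-mono : ∀ {n} {f g : Fin n → ℕ} → (∀ v → f v ≤ g v) → sum f ≤ sum g
sum-mono {zero}  _   = z≤n
sum-mono {suc n} f≤g = +-mono-≤ (f≤g fzero) (sum-mono (f≤g ∘ fsuc))

weight-cong : ∀ {n} {A B : ℙ n} {f g : Fin n → ℕ} →
  (∀ v → A v ≡ B v) → (∀ v → A v ≡ true → f v ≡ g v) → weight A f ≡ weight B g
weight-cong {A = A} {B} {f} {g} A≗B f≗g = sum-cong-≗ pointwise
  where
    pointwise : ∀ v → (if A v then f v else 0) ≡ (if B v then g v else 0)
    pointwise v rewrite sym (A≗B v) with A v | f≗g v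
    ... | true  | f≡g = f≡g refl
    ... | false | _   = refl

weight-split : ∀ {n} (A B : ℙ n) (f : Fin n → ℕ) →
  weight A f ≡ weight (A ∩ B) f + weight (A ∖ B) f
weight-split {n} A B f = trans (sum-cong-≗ pointwise) (∑-distrib-+ {n} _ _)
  where
    pointwise : ∀ v → (if A v then f v else 0)
                    ≡ (if (A ∩ B) v then f v else 0) + (if (A ∖ B) v then f v else 0)
    pointwise v with A v | B v
    ... | true  | true  = sym (+-identityʳ (f v))
    ... | true  | false = refl
    ... | false | _     = refl

weight-const : ∀ {n} {A : ℙ n} {f : Fin n → ℕ} (c : ℕ) →
  (∀ v → A v ≡ true → f v ≡ c) → weight A f ≡ c * size A
weight-const {n} {A} {f} c f≡c = begin
  weight A f                                 ≡⟨ weight-cong (λ _ → refl) f≡c ⟩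
  weight A (λ _ → c)                         ≡⟨ sum-cong-≗ scale ⟩
  sum (λ v → c * (if A v then 1 else 0))     ≡⟨ *-distribˡ-sum {n} c _ ⟨
  c * size A                                 ∎
  where
    open ≡-Reasoning
    scale : ∀ v → (if A v then c else 0) ≡ c * (if A v then 1 else 0)
    scale v with A v
    ... | true  = sym (*-identityʳ c)
    ... | false = sym (*-zeroʳ c)

weight-⊆ : ∀ {n} {A B : ℙ n} (f : Fin n → ℕ) → A ⊆ B → weight A f ≤ weight B f
weight-⊆ {A = A} {B} f A⊆B = sum-mono pointwise
  where
    pointwise : ∀ v → (if A v then f v else 0) ≤ (if B v then f v else 0)
    pointwise v with A v in A-v | B v in B-v
    ... | false | _     = z≤n
    ... | true  | true  = ≤-refl
    ... | true  | false with trans (sym (A⊆B v A-v)) B-v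
    ...   | ()

weight-bound : ∀ {n} {A : ℙ n} {f : Fin n → ℕ} (k : ℕ) →
  (∀ v → A v ≡ true → f v ≤ k) → weight A f ≤ k * size A
weight-bound {A = A} {f} k f≤k =
  ≤-trans (sum-mono pointwise) (≤-reflexive (weight-const {A = A} k (λ _ _ → refl)))
  where
    pointwise : ∀ v → (if A v then f v else 0) ≤ (if A v then k else 0)
    pointwise v with A v in A-v
    ... | true  = f≤k v A-v
    ... | false = z≤n

member⇒size-pos : ∀ {n} (A : ℙ n) {v} → A v ≡ true → 1 ≤ size A
member⇒size-pos {suc n} A {v} A-v =
  ≤-trans (≤-reflexive (cong (λ b → if b then 1 else 0) (sym A-v)))
          (≤-trans (m≤m+n _ _) (≤-reflexive (sym (sum-remove {n} {i = v} (λ u → if A u then 1 else 0)))))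

size-pos⇒member : ∀ {n} (A : ℙ n) → 1 ≤ size A → ∃ λ v → A v ≡ true
size-pos⇒member {n} A 1≤|A| with any? (λ v → A v Bool.≟ true)
... | yes found = found
... | no  none  = ⊥-elim (<-irrefl refl (≤-trans 1≤|A| (≤-reflexive size≡0)))
  where
    size≡0 : size A ≡ 0
    size≡0 = trans (weight-cong {B = λ _ → false} empty (λ _ _ → refl)) (sum-replicate-zero n)
      where
        empty : ∀ v → A v ≡ false
        empty v with A v in A-v
        ... | true  = ⊥-elim (none (v , A-v))
        ... | false = refl

subset-of-size : ∀ {n} (A : ℙ n) (j : ℕ) → j ≤ size A → ∃ λ X → X ⊆ A × size X ≡ j
subset-of-size {n} A zero _ = (λ _ → false) , (λ _ ()) , sum-replicate-zero n
subset-of-size {zero} A (suc j) ()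
subset-of-size {suc n} A (suc j) j<|A| with A fzero in A-0
... | true with subset-of-size (A ∘ fsuc) j (≤-pred j<|A|)
...   | X , X⊆A , |X| = (true Vector.∷ X) , (λ { fzero _ → A-0 ; (fsuc v) → X⊆A v }) , cong suc |X|
subset-of-size {suc n} A (suc j) j<|A| | false with subset-of-size (A ∘ fsuc) (suc j) j<|A|
...   | X , X⊆A , |X| = (false Vector.∷ X) , (λ { fzero () ; (fsuc v) → X⊆A v }) , |X|

wsum≡weight : ∀ {n} (w : Fin n → ℕ) (D : Subset n) → wsum w D ≡ weight (lookup D) w
wsum≡weight w []      = refl
wsum≡weight w (b ∷ D) = cong ((if b then w fzero else 0) +_) (wsum≡weight (w ∘ fsuc) D)

∣∣≡size : ∀ {n} (S : Subset n) → ∣ S ∣ ≡ size (lookup S)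
∣∣≡size []          = refl
∣∣≡size (true ∷ S)  = cong suc (∣∣≡size S)
∣∣≡size (false ∷ S) = ∣∣≡size S

∣∁∣≡size : ∀ {n} (S : Subset n) → ∣ ∁ S ∣ ≡ size (not ∘ lookup S)
∣∁∣≡size S = trans (∣∣≡size (∁ S)) (weight-cong (λ v → lookup-map v not S) (λ _ _ → refl))

fiber : ∀ {n} → (Fin n → ℕ) → ℕ → ℙ n
fiber f c v = f v ≡ᵇ c

below : ∀ {n} → (Fin n → ℕ) → ℕ → ℙ n
below f b v = f v <ᵇ b

<ᵇ-suc : ∀ x b → (if x <ᵇ suc b then 1 else 0)
               ≡ (if x <ᵇ b then 1 else 0) + (if x ≡ᵇ b then 1 else 0)
<ᵇ-suc zero    zero    = refl
<ᵇ-suc zero    (suc b) = refl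
<ᵇ-suc (suc x) zero    = refl
<ᵇ-suc (suc x) (suc b) = <ᵇ-suc x b

count-values : ∀ {n} (A : ℙ n) (f : Fin n → ℕ) (B : ℕ) →
  (∀ v → A v ≡ true → 1 ≤ f v) → ∀ b →
  (∃ λ c → 1 ≤ c × c ≤ b × B ≤ size (A ∩ fiber f c)) ⊎ size (A ∩ below f (suc b)) + b ≤ b * B
count-values {n} A f B positive zero =
  inj₂ (≤-reflexive (trans (+-identityʳ _) (trans (weight-cong none (λ _ _ → refl)) (sum-replicate-zero n))))
  where
    none : ∀ v → (A ∩ below f 1) v ≡ false
    none v with A v in A-v
    ... | false = refl
    ... | true with f v | positive v A-v
    ...   | suc _ | _ = refl
count-values {n} A f B positive (suc b) with count-values A f B positive b
... | inj₁ (c , 1≤c , c≤b , B≤) = inj₁ (c , 1≤c , m≤n⇒m≤1+n c≤b , B≤)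
... | inj₂ few with B ≤? size (A ∩ fiber f (suc b))
...   | yes B≤ = inj₁ (suc b , s≤s z≤n , ≤-refl , B≤)
...   | no  B≰ = inj₂ (begin
  size (A ∩ below f (suc (suc b))) + suc b  ≡⟨ cong (_+ suc b) step ⟩
  (lower + level) + suc b                   ≡⟨ rearrange lower level b ⟩
  (lower + b) + suc level                   ≤⟨ +-mono-≤ few (≰⇒> B≰) ⟩
  b * B + B                                 ≡⟨ +-comm (b * B) B ⟩
  suc b * B                                 ∎)
  where
    open ≤-Reasoning
    lower level : ℕ
    lower = size (A ∩ below f (suc b))
    level = size (A ∩ fiber f (suc b))
    step : size (A ∩ below f (suc (suc b))) ≡ lower + level
    step = trans (sum-cong-≗ pointwise) (∑-distrib-+ {n} _ _)
      where
        pointwise : ∀ v → (if (A ∩ below f (suc (suc b))) v then 1 else 0)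
          ≡ (if (A ∩ below f (suc b)) v then 1 else 0) + (if (A ∩ fiber f (suc b)) v then 1 else 0)
        pointwise v with A v
        ... | true  = <ᵇ-suc (f v) (suc b)
        ... | false = refl
    rearrange : ∀ x y z → (x + y) + suc z ≡ (x + z) + suc y
    rearrange = solve 3 (λ x y z → (x :+ y) :+ (con 1 :+ z) := (x :+ z) :+ (con 1 :+ y)) refl
      where open +-*-Solver

pigeonhole : ∀ {n} (A : ℙ n) (f : Fin n → ℕ) (k B : ℕ) →
  (∀ v → A v ≡ true → 1 ≤ f v × f v ≤ k) → 1 ≤ k → k * B ≤ size A →
  ∃ λ c → 1 ≤ c × c ≤ k × B ≤ size (A ∩ fiber f c)
pigeonhole A f k B range 1≤k k*B≤|A| with count-values A f B (λ v → proj₁ ∘ range v) k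
... | inj₁ found = found
... | inj₂ few   = ⊥-elim (<-irrefl refl (begin-strict
  size A                          <⟨ m<m+n (size A) 1≤k ⟩
  size A + k                      ≡⟨ cong (_+ k) all-below ⟨
  size (A ∩ below f (suc k)) + k  ≤⟨ few ⟩
  k * B                           ≤⟨ k*B≤|A| ⟩
  size A                          ∎))
  where
    open ≤-Reasoning
    all-below : size (A ∩ below f (suc k)) ≡ size A
    all-below = weight-cong all (λ _ _ → refl)
      where
        all : ∀ v → (A ∩ below f (suc k)) v ≡ A v
        all v with A v in A-v
        ... | true  = Equivalence.to T-≡ (<⇒<ᵇ (s≤s (proj₂ (range v A-v))))
        ... | false = refl

⊆⇒≡⊎⊂ : ∀ {n} {p q : Subset n} → p ⊆ᵥ q → p ≡ q ⊎ p ⊂ q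
⊆⇒≡⊎⊂ {p = p} {q} p⊆q with any? (λ x → x ∈? q ×-dec ¬? (x ∈? p))
... | yes (x , x∈q , x∉p) = inj₂ (p⊆q , x , x∈q , x∉p)
... | no  none            = inj₁ (⊆-antisym p⊆q q⊆p)
  where
    q⊆p : q ⊆ᵥ p
    q⊆p {x} x∈q = decidable-stable (x ∈? p) (λ x∉p → none (x , x∈q , x∉p))

dominating? : ∀ {n} (G : Graph n) (D : Subset n) → Dec (Dominating G D)
dominating? G D =
  all? (λ v → v ∈? D ⊎-dec any? (λ u → u ∈? D ×-dec Graph.adj G u v Bool.≟ true))

-- Every dominating set D with |D| < b contains an mds: pass to a dominating
-- proper subset as long as one exists; |D| decreases at each step.
mds-below : ∀ {n} (G : Graph n) (b : ℕ) (D : Subset n) →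
  ∣ D ∣ < b → Dominating G D → ∃ (MDS G)
mds-below G (suc b) D (s≤s |D|≤b) dom
  with anySubset? (λ D′ → D′ ⊂? D ×-dec dominating? G D′)
... | yes (D′ , D′⊂D , dom′) = mds-below G b D′ (<-≤-trans (p⊂q⇒∣p∣<∣q∣ D′⊂D) |D|≤b) dom′
... | no  none               = D , dom , minimal
  where
    minimal : ∀ D′ → D′ ⊆ᵥ D → Dominating G D′ → D′ ≡ D
    minimal D′ D′⊆D dom′ with ⊆⇒≡⊎⊂ D′⊆D
    ... | inj₁ D′≡D = D′≡D
    ... | inj₂ D′⊂D = ⊥-elim (none (D′ , D′⊂D , dom′))

mds-exists : ∀ {n} (G : Graph n) → ∃ (MDS G)
mds-exists {n} G = mds-below G (suc n) ⊤ (s≤s (∣p∣≤n ⊤)) (λ _ → inj₁ ∈⊤)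

isolated∈dominating : ∀ {n} (G : Graph n) {D : Subset n} {v : Fin n} →
  (∀ u → ¬ Adj G v u) → Dominating G D → lookup D v ≡ true
isolated∈dominating G {D} {v} no-neighbour dom with dom v
... | inj₁ v∈D             = []=⇒lookup v∈D
... | inj₂ (u , _ , u~v)   = ⊥-elim (no-neighbour u (trans (Graph.sym G v u) u~v))

reweight : ∀ {n} → ℙ n → ℕ → (Fin n → ℕ) → Fin n → ℕ
reweight S c w v = if S v then c else w v

module Reweighting {n} (G : Graph n) (k : ℕ) (w : Fin n → ℕ)
  (isEq : IsEquidominatingFn G k w)
  (S : ℙ n) (forced : ∀ D → MDS G D → S ⊆ lookup D)
  (c : ℕ) (1≤c : 1 ≤ c) (c≤k : c ≤ k)
  (enough : weight (not ∘ S) w ≤ size (S ∩ fiber w c)) where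

  range : ∀ v → 1 ≤ w v × w v ≤ k
  range = proj₁ isEq

  t : ℕ
  t = proj₁ (proj₂ isEq)

  1≤t : 1 ≤ t
  1≤t = proj₁ (proj₂ (proj₂ isEq))

  MDS⇔weight≡t : ∀ D → MDS G D ⇔ weight (lookup D) w ≡ t
  MDS⇔weight≡t D = mk⇔
    (λ mds → trans (sym (wsum≡weight w D)) (Equivalence.to (equi D) mds))
    (λ w≡t → Equivalence.from (equi D) (trans (wsum≡weight w D) w≡t))
    where
      equi : ∀ D → MDS G D ⇔ wsum w D ≡ t
      equi = proj₂ (proj₂ (proj₂ isEq))

  w′ : Fin n → ℕ
  w′ = reweight S c w

  -- Since an mds exists and contains S, the target is at least w(S); the
  -- new target replaces w(S) by c·|S|.
  S≤t : weight S w ≤ t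
  S≤t with mds-exists G
  ... | D , mds = ≤-trans (weight-⊆ w (forced D mds)) (≤-reflexive (Equivalence.to (MDS⇔weight≡t D) mds))

  r t′ : ℕ
  r  = t ∸ weight S w
  t′ = r + c * size S

  S+r≡t : weight S w + r ≡ t
  S+r≡t = m+[n∸m]≡n S≤t

  w′-split : ∀ D → weight D w′ ≡ weight (D ∖ S) w + c * size (D ∩ S)
  w′-split D = begin
    weight D w′                               ≡⟨ weight-split D S w′ ⟩
    weight (D ∩ S) w′ + weight (D ∖ S) w′     ≡⟨ cong₂ _+_ (weight-const c on-S) (weight-cong (λ _ → refl) off-S) ⟩
    c * size (D ∩ S) + weight (D ∖ S) w       ≡⟨ +-comm (c * size (D ∩ S)) (weight (D ∖ S) w) ⟩
    weight (D ∖ S) w + c * size (D ∩ S)       ∎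
    where
      open ≡-Reasoning
      on-S : ∀ v → (D ∩ S) v ≡ true → w′ v ≡ c
      on-S v DS-v rewrite ∧-elimʳ (D v) DS-v = refl
      off-S : ∀ v → (D ∖ S) v ≡ true → w′ v ≡ w v
      off-S v D∖S-v with S v | ∧-elimʳ (D v) D∖S-v
      ... | false | _ = refl

  module _ {D : ℙ n} (S⊆D : S ⊆ D) where
    w-⊇S : weight D w ≡ weight S w + weight (D ∖ S) w
    w-⊇S = trans (weight-split D S w) (cong (_+ weight (D ∖ S) w) (weight-cong (∩-⊆ S⊆D) (λ _ _ → refl)))

    w′-⊇S : weight D w′ ≡ weight (D ∖ S) w + c * size S
    w′-⊇S = trans (w′-split D) (cong (λ a → weight (D ∖ S) w + c * a) (weight-cong (∩-⊆ S⊆D) (λ _ _ → refl)))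

    old⇒new : weight D w ≡ t → weight D w′ ≡ t′
    old⇒new w≡t = trans w′-⊇S (cong (_+ c * size S) outside≡r)
      where
        outside≡r : weight (D ∖ S) w ≡ r
        outside≡r = +-cancelˡ-≡ (weight S w) _ _ (trans (sym w-⊇S) (trans w≡t (sym S+r≡t)))

    new⇒old : weight D w′ ≡ t′ → weight D w ≡ t
    new⇒old w′≡t′ = trans w-⊇S (trans (cong (weight S w +_) outside≡r) S+r≡t)
      where
        outside≡r : weight (D ∖ S) w ≡ r
        outside≡r = +-cancelʳ-≡ (c * size S) _ _ (trans (sym w′-⊇S) w′≡t′)

  -- Otherwise E = (D ∖ S) ∪ (S ∖ X) has
  -- w(E) = w(S ∖ X) + r + c·|X| = w(S) + r = t, so E is an mds, yet E misses
  -- the vertices of X ⊆ S.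
  exchange : (X : ℙ n) → X ⊆ S ∩ fiber w c → ∀ {x} → X x ≡ true →
    (D : ℙ n) → weight (D ∖ S) w ≡ r + c * size X → ⊥
  exchange X X⊆C {x} X-x D outside≡ = subst T (trans (sym x∈E) x∉E) tt
    where
      E : ℙ n
      E = patch S (not ∘ X) D

      X⊆S : X ⊆ S
      X⊆S v X-v = ∧-elimˡ (S v) (X⊆C v X-v)

      S-x : S x ≡ true
      S-x = X⊆S x X-x

      S-split : weight S w ≡ c * size X + weight (S ∖ X) w
      S-split = trans (weight-split S X w) (cong (_+ weight (S ∖ X) w)
        (trans (weight-cong (∩-⊆ X⊆S) (λ _ _ → refl))
               (weight-const c (λ v X-v → ≡ᵇ⇒≡ (w v) c (Equivalence.from T-≡ (∧-elimʳ (S v) (X⊆C v X-v)))))))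

      E-weight : weight E w ≡ t
      E-weight = begin
        weight E w                               ≡⟨ weight-split E S w ⟩
        weight (E ∩ S) w + weight (E ∖ S) w      ≡⟨ cong₂ _+_ (weight-cong (patch-∩ S (not ∘ X) D) (λ _ _ → refl))
                                                              (weight-cong (patch-∖ S (not ∘ X) D) (λ _ _ → refl)) ⟩
        weight (S ∖ X) w + weight (D ∖ S) w      ≡⟨ cong (weight (S ∖ X) w +_) outside≡ ⟩
        weight (S ∖ X) w + (r + c * size X)      ≡⟨ rearrange (weight (S ∖ X) w) r (c * size X) ⟩
        (c * size X + weight (S ∖ X) w) + r      ≡⟨ cong (_+ r) S-split ⟨
        weight S w + r                           ≡⟨ S+r≡t ⟩
        t                                        ∎
        where
          open ≡-Reasoning
          rearrange : ∀ a b d → a + (b + d) ≡ (d + a) + b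
          rearrange = solve 3 (λ a b d → a :+ (b :+ d) := (d :+ a) :+ b) refl
            where open +-*-Solver

      E-mds : MDS G (tabulate E)
      E-mds = Equivalence.from (MDS⇔weight≡t (tabulate E))
        (trans (weight-cong (lookup∘tabulate E) (λ _ _ → refl)) E-weight)

      x∉E : E x ≡ false
      x∉E rewrite S-x | X-x = refl

      x∈E : E x ≡ true
      x∈E = trans (sym (lookup∘tabulate E x)) (forced (tabulate E) E-mds x S-x)

  outside-weight : ∀ D → weight D w′ ≡ t′ → weight (D ∖ S) w ≡ r + c * size (S ∖ D)
  outside-weight D w′≡t′ = +-cancelʳ-≡ (c * a) _ _ (begin
    weight (D ∖ S) w + c * a   ≡⟨ w′-split D ⟨
    weight D w′                ≡⟨ w′≡t′ ⟩
    r + c * size S             ≡⟨ cong (λ s → r + c * s) S≡a+j ⟩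
    r + c * (a + j)            ≡⟨ rearrange r c a j ⟩
    (r + c * j) + c * a        ∎)
    where
      open ≡-Reasoning
      a j : ℕ
      a = size (D ∩ S)
      j = size (S ∖ D)
      S≡a+j : size S ≡ a + j
      S≡a+j = trans (weight-split S D _) (cong (_+ j) (weight-cong (λ v → ∧-comm (S v) (D v)) (λ _ _ → refl)))
      rearrange : ∀ r c a j → r + c * (a + j) ≡ (r + c * j) + c * a
      rearrange = solve 4 (λ r c a j → r :+ c :* (a :+ j) := (r :+ c :* j) :+ c :* a) refl
        where open +-*-Solver

  missing≤fiber : ∀ D → weight D w′ ≡ t′ → size (S ∖ D) ≤ size (S ∩ fiber w c)
  missing≤fiber D w′≡t′ = begin
    j                       ≡⟨ *-identityˡ j ⟨
    1 * j                   ≤⟨ *-monoˡ-≤ j 1≤c ⟩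
    c * j                   ≤⟨ m≤n+m (c * j) r ⟩
    r + c * j               ≡⟨ outside-weight D w′≡t′ ⟨
    weight (D ∖ S) w        ≤⟨ weight-⊆ w (λ v → ∧-elimʳ (D v)) ⟩
    weight (not ∘ S) w      ≤⟨ enough ⟩
    size (S ∩ fiber w c)    ∎
    where
      open ≤-Reasoning
      j : ℕ
      j = size (S ∖ D)

  -- Hence a set reaching the new target contains S: otherwise choose
  -- |S ∖ D| vertices of S of weight c and apply the exchange lemma.
  new-target⇒⊇S : ∀ D → weight D w′ ≡ t′ → S ⊆ D
  new-target⇒⊇S D w′≡t′ with ⊆-or-witness S D
  ... | inj₁ S⊆D = S⊆D
  ... | inj₂ (v , S∖D-v)
    with subset-of-size (S ∩ fiber w c) (size (S ∖ D)) (missing≤fiber D w′≡t′)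
  ...   | X , X⊆C , |X|≡j
    with size-pos⇒member X (subst (1 ≤_) (sym |X|≡j) (member⇒size-pos (S ∖ D) S∖D-v))
  ...     | x , X-x = ⊥-elim (exchange X X⊆C X-x D
                (subst (λ i → weight (D ∖ S) w ≡ r + c * i) (sym |X|≡j) (outside-weight D w′≡t′)))

  -- The new target is positive: if S = ∅ it equals t, else c·|S| ≥ 1.
  1≤t′ : 1 ≤ t′
  1≤t′ = positive (size S) (weight-bound k (λ v _ → proj₂ (range v)))
    where
      positive : ∀ s → weight S w ≤ k * s → 1 ≤ r + c * s
      positive zero S≤0 = begin
        1                  ≤⟨ 1≤t ⟩
        t                  ≡⟨ S+r≡t ⟨
        weight S w + r     ≤⟨ +-monoˡ-≤ r (≤-trans S≤0 (≤-reflexive (*-zeroʳ k))) ⟩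
        r                  ≤⟨ m≤m+n r (c * 0) ⟩
        r + c * 0          ∎
        where open ≤-Reasoning
      positive (suc s) _ = ≤-trans (*-mono-≤ 1≤c (s≤s z≤n)) (m≤n+m (c * suc s) r)

  w′-range : ∀ v → 1 ≤ w′ v × w′ v ≤ k
  w′-range v with S v
  ... | true  = 1≤c , c≤k
  ... | false = range v

  equidominating : IsEquidominatingFn G k w′
  equidominating = w′-range , t′ , 1≤t′ , λ D → mk⇔ (mds⇒new D) (new⇒mds D)
    where
      mds⇒new : ∀ D → MDS G D → wsum w′ D ≡ t′
      mds⇒new D mds = trans (wsum≡weight w′ D)
        (old⇒new (forced D mds) (Equivalence.to (MDS⇔weight≡t D) mds))
      new⇒mds : ∀ D → wsum w′ D ≡ t′ → MDS G D
      new⇒mds D w′≡t′ = Equivalence.from (MDS⇔weight≡t D)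
        (new⇒old (new-target⇒⊇S (lookup D) w′≡t′′) w′≡t′′)
        where
          w′≡t′′ : weight (lookup D) w′ ≡ t′
          w′≡t′′ = trans (sym (wsum≡weight w′ D)) w′≡t′

lemma7p3 : (n : ℕ) (G : Graph n) (k : ℕ) → 1 ≤ k → (S : Subset n) →
    IsolatedStableSetClass G S → k ^ 5 ≤ ∣ S ∣ → ∣ ∁ S ∣ ≤ k ^ 3 →
    (Equidominating G k ⇔ (∃ λ w → IsEquidominatingFn G k w × ConstantOn w S))
lemma7p3 n G k 1≤k S isolated k⁵≤|S| |∁S|≤k³ = mk⇔ constant-version (λ (w , isEq , _) → w , isEq)
  where
    forced : ∀ D → MDS G D → lookup S ⊆ lookup D
    forced D mds v S-v = isolated∈dominating G (proj₂ isolated v (lookup⇒[]= v S S-v)) (proj₁ mds)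

    constant-version : Equidominating G k → ∃ λ w → IsEquidominatingFn G k w × ConstantOn w S
    constant-version (w , isEq)
      with pigeonhole (lookup S) w k (k ^ 4) (λ v _ → proj₁ isEq v) 1≤k
             (subst (k ^ 5 ≤_) (∣∣≡size S) k⁵≤|S|)
    ... | c , 1≤c , c≤k , k⁴≤fiber =
      reweight (lookup S) c w ,
      Reweighting.equidominating G k w isEq (lookup S) forced c 1≤c c≤k outside-light ,
      constant
      where
        outside-light : weight (not ∘ lookup S) w ≤ size (lookup S ∩ fiber w c)
        outside-light = ≤-trans (weight-bound k (λ v _ → proj₂ (proj₁ isEq v)))
          (≤-trans (*-monoʳ-≤ k (subst (_≤ k ^ 3) (∣∁∣≡size S) |∁S|≤k³)) k⁴≤fiber)

        constant : ConstantOn (reweight (lookup S) c w) S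
        constant u v u∈S v∈S rewrite []=⇒lookup u∈S | []=⇒lookup v∈S = refl
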